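{- Work in CCSK$^{\mathrm{P}}$ as described in the context. (i) Let $t_1 : X_1 \xrightarrow{\theta_1} X_1'$ and $t_2 : X_2 \xrightarrow{\theta_2} X_2'$ be combined (forward or backward) transitions such that $t_1$ and $t_2$ are connected, and suppose $X_1$ is reachable. Then $\theta_1 \bowtie \theta_2$. (ii) Let $\theta_1,\theta_2$ be proof keyed labels with $\theta_1 \bowtie \theta_2$. Then there exist combined transitions $t_1 : X_1 \xrightarrow{\theta_1} X_1'$ and $t_2 : X_2 \xrightarrow{\theta_2} X_2'$ such that $X_1$ is reachable and $t_1$ and $t_2$ are connected.
   Context: Syntax. $\mathsf N$ is an infinite set of names ($a,b,c$), with a bijection $a\mapsto\overline a$ onto a disjoint set $\overline{\mathsf N}$ of co-names (with $\overline{\overline a}=a$). Labels: $\mathsf L=\mathsf N\cup\overline{\mathsf N}\cup\{\tau\}$, ranged over by $\alpha$; $\lambda$ ranges over $\mathsf L\setminus\{\tau\}$. $\mathsf K$ is a denumerable set of keys ($k,m,n$) with decidable equality. Processes: $X,Y ::= \mathbf 0 \mid \alpha.X \mid \alpha[k].X \mid X+Y \mid X\mid Y \mid X\setminus a$ (with $a\in\mathsf N$); $X\setminus a$ binds $a$ in $X$ and $\alpha$-equivalent processes are identified. $\mathrm{keys}(X)$ is the set of keys occurring in $X$; $X$ is standard, $\mathrm{std}(X)$, iff $\mathrm{keys}(X)=\emptyset$. Proof keyed labels: $\theta ::= v\,\alpha[k] \mid v\,\langle \theta_L,\theta_R\rangle$ where $v,v_1,v_2$ are finite strings over the symbols $\{|_L,|_R,+_L,+_R\}$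 and in a synchronisation label $\theta_L=v_1\lambda[k]$, $\theta_R=v_2\overline\lambda[k]$ (same key $k$; informally written $\langle |_L v_1\lambda[k], |_R v_2\overline\lambda[k]\rangle$). Writing $s\theta$ for prefixing symbol $s$ to $\theta$: $\ell(v\alpha[k])=\alpha$, $\ell(v\langle\theta_L,\theta_R\rangle)=\tau$, $\mathrm{key}(v\alpha[k])=k$, $\mathrm{key}(v\langle v_1\lambda[k],v_2\overline\lambda[k]\rangle)=k$. Forward rules ($\to_f$): (pref) $\alpha.X\xrightarrow{\alpha[k]}_f\alpha[k].X$ if $\mathrm{std}(X)$; (kpref) if $X\xrightarrow{\theta}_f X'$ and $\mathrm{key}(\theta)\neq k$ then $\alpha[k].X\xrightarrow{\theta}_f\alpha[k].X'$; ($+_L$) if $X\xrightarrow{\theta}_f X'$ and $\mathrm{std}(Y)$ then $X+Y\xrightarrow{+_L\theta}_f X'+Y$; ($+_R$) if $Y\xrightarrow{\theta}_f Y'$ and $\mathrm{std}(X)$ then $X+Y\xrightarrow{+_R\theta}_f X+Y'$; ($|_L$) if $X\xrightarrow{\theta}_f X'$ and $\mathrm{key}(\theta)\notin\mathrm{keys}(Y)$ then $X\mid Y\xrightarrow{|_L\theta}_f X'\mid Y$; ($|_R$) symmetrically with label $|_R\theta$; (syn) if $X\xrightarrow{v_1\lambda[k]}_f X'$ and $Y\xrightarrow{v_2\overline\lambda[k]}_f Y'$ then $X\mid Y\xrightarrow{\langle v_1\lambda[k],v_2\overline\lambda[k]\rangle}_f X'\mid Y'$; (nu) if $X\xrightarrow{\theta}_f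 X'$ and $\ell(\theta)\notin\{a,\overline a\}$ then $X\setminus a\xrightarrow{\theta}_f X'\setminus a$. Backward rules ($\to_b$) are the mirror images: each forward rule with every transition reversed (e.g. $\alpha[k].X\xrightarrow{\alpha[k]}_b\alpha.X$ if $\mathrm{std}(X)$; if $X'\xrightarrow{\theta}_b X$ and $\mathrm{std}(Y)$ then $X'+Y\xrightarrow{+_L\theta}_b X+Y$; etc.), with the same side conditions. A combined transition $X\xrightarrow{\theta}Y$ is a forward or a backward one; $X$ is its source, $Y$ its target. A path is a finite, possibly empty, sequence of consecutive combined transitions (reflexive–transitive closure). $X$ is reachable if there is a path from some standard process to $X$. Two transitions $t_1: X_1\xrightarrow{\theta_1}X_1'$, $t_2: X_2\xrightarrow{\theta_2}X_2'$ are connected if there is a path from $X_1$ to $X_2$. Connectivity $\bowtie$ on proof labels is the least relation closed under the rules (for $D\in\{L,R\}$, $\overline L=R$, $\overline R=L$; $\alpha[k]$ denotes a label with empty string $v$): (A$^1$) $\alpha[k]\bowtie\theta$; (A$^2$) $\theta\bowtie\alpha[k]$; (P$^1_D$) $\theta_1\bowtie\theta_2\Rightarrow |_D\theta_1\bowtie|_D\theta_2$; (P$^2_D$) $|_D\theta_1\bowtie|_{\overline D}\theta_2$; (C$^1_D$) $\theta_1\bowtie\theta_2\Rightarrow +_D\theta_1\bowtie+_D\theta_2$; (C$^2_D$) $+_D\theta_1\bowtie+_{\overline D}\theta_2$; (S$^1_D$) $\theta\bowtie\theta_D\Rightarrow |_D\theta\bowtie\langle\theta_L,\theta_R\rangle$;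 (S$^2_D$) $\theta_D\bowtie\theta\Rightarrow\langle\theta_L,\theta_R\rangle\bowtie|_D\theta$; (S$^3$) $\theta_1\bowtie\theta_1'$ and $\theta_2\bowtie\theta_2'$ $\Rightarrow\langle\theta_1,\theta_2\rangle\bowtie\langle\theta_1',\theta_2'\rangle$. -}

module Defs where

open import Data.Nat using (ℕ; _≟_)
open import Data.List using (List; []; _∷_)
open import Data.Product using (Σ; ∃; _×_; _,_)
open import Data.Sum using (_⊎_)
open import Relation.Nullary using (¬_; yes; no)
open import Relation.Binary.PropositionalEquality using (_≡_; _≢_)

Name : Set
Name = ℕ

data Vis : Set where
  nm : Name → Vis
  co : Name → Vis

bar : Vis → Vis
bar (nm a) = co a
bar (co a) = nm a

data Act : Set where
  vis : Vis → Act
  τ   : Act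

Key : Set
Key = ℕ

-- Processes (raw, named syntax; α-equivalence is handled below)

infixr 8 _∙_ _[_]∙_
infixl 6 _⊕_
infixl 5 _∥_

data Proc : Set where
  𝟎     : Proc
  _∙_    : Act → Proc → Proc
  _[_]∙_ : Act → Key → Proc → Proc
  _⊕_   : Proc → Proc → Proc
  _∥_   : Proc → Proc → Proc
  ν     : Name → Proc → Proc           -- X \ a  (written ν a X)

data KeyIn (k : Key) : Proc → Set where
  here  : ∀ {α X} → KeyIn k (α [ k ]∙ X)
  kpre  : ∀ {α m X} → KeyIn k X → KeyIn k (α [ m ]∙ X)
  pre   : ∀ {α X} → KeyIn k X → KeyIn k (α ∙ X)
  sumL  : ∀ {X Y} → KeyIn k X → KeyIn k (X ⊕ Y)
  sumR  : ∀ {X Y} → KeyIn k Y → KeyIn k (X ⊕ Y)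
  parL  : ∀ {X Y} → KeyIn k X → KeyIn k (X ∥ Y)
  parR  : ∀ {X Y} → KeyIn k Y → KeyIn k (X ∥ Y)
  res   : ∀ {a X} → KeyIn k X → KeyIn k (ν a X)

std : Proc → Set
std X = ∀ k → ¬ KeyIn k X

-- α-equivalence (nominal style, via swapping and freshness)

swapN : Name → Name → Name → Name
swapN a b c with c ≟ a
... | yes _ = b
... | no _ with c ≟ b
...   | yes _ = a
...   | no _ = c

swapV : Name → Name → Vis → Vis
swapV a b (nm c) = nm (swapN a b c)
swapV a b (co c) = co (swapN a b c)

swapA : Name → Name → Act → Act
swapA a b (vis l) = vis (swapV a b l)
swapA a b τ = τ

swapP : Name → Name → Proc → Proc
swapP a b 𝟎 = 𝟎
swapP a b (α ∙ X) = swapA a b α ∙ swapP a b X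
swapP a b (α [ k ]∙ X) = swapA a b α [ k ]∙ swapP a b X
swapP a b (X ⊕ Y) = swapP a b X ⊕ swapP a b Y
swapP a b (X ∥ Y) = swapP a b X ∥ swapP a b Y
swapP a b (ν c X) = ν (swapN a b c) (swapP a b X)

data NameIn (a : Name) : Act → Set where
  inNm : NameIn a (vis (nm a))
  inCo : NameIn a (vis (co a))

data FreeIn (a : Name) : Proc → Set where
  preA  : ∀ {α X} → NameIn a α → FreeIn a (α ∙ X)
  preX  : ∀ {α X} → FreeIn a X → FreeIn a (α ∙ X)
  kpreA : ∀ {α k X} → NameIn a α → FreeIn a (α [ k ]∙ X)
  kpreX : ∀ {α k X} → FreeIn a X → FreeIn a (α [ k ]∙ X)
  sumL  : ∀ {X Y} → FreeIn a X → FreeIn a (X ⊕ Y)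
  sumR  : ∀ {X Y} → FreeIn a Y → FreeIn a (X ⊕ Y)
  parL  : ∀ {X Y} → FreeIn a X → FreeIn a (X ∥ Y)
  parR  : ∀ {X Y} → FreeIn a Y → FreeIn a (X ∥ Y)
  res   : ∀ {b X} → a ≢ b → FreeIn a X → FreeIn a (ν b X)

infix 4 _≈α_
data _≈α_ : Proc → Proc → Set where
  nil   : 𝟎 ≈α 𝟎
  pre   : ∀ {α X Y} → X ≈α Y → α ∙ X ≈α α ∙ Y
  kpre  : ∀ {α k X Y} → X ≈α Y → α [ k ]∙ X ≈α α [ k ]∙ Y
  sum   : ∀ {X X' Y Y'} → X ≈α X' → Y ≈α Y' → X ⊕ Y ≈α X' ⊕ Y'
  par   : ∀ {X X' Y Y'} → X ≈α X' → Y ≈α Y' → X ∥ Y ≈α X' ∥ Y'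
  res   : ∀ {a X Y} → X ≈α Y → ν a X ≈α ν a Y
  res≠  : ∀ {a b X Y} → a ≢ b → ¬ FreeIn a Y → X ≈α swapP a b Y → ν a X ≈α ν b Y

data Sym : Set where
  |L |R +L +R : Sym

-- lab v α k     represents  v α[k]
-- syn v θL θR   represents  v ⟨θL , θR⟩
data Θ : Set where
  lab : List Sym → Act → Key → Θ
  syn : List Sym → Θ → Θ → Θ

data WF : Θ → Set where
  wf-lab : ∀ {v α k} → WF (lab v α k)
  wf-syn : ∀ {v v₁ v₂ k} (l : Vis) →
           WF (syn v (lab v₁ (vis l) k) (lab v₂ (vis (bar l)) k))

infixr 7 _◃_
_◃_ : Sym → Θ → Θ
s ◃ lab v α k = lab (s ∷ v) α k
s ◃ syn v θL θR = syn (s ∷ v) θL θR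

ℓ : Θ → Act
ℓ (lab v α k) = α
ℓ (syn v θL θR) = τ

key : Θ → Key
key (lab v α k) = k
key (syn v θL θR) = key θL

data Fwd : Proc → Θ → Proc → Set where
  pref  : ∀ {α k X} → std X → Fwd (α ∙ X) (lab [] α k) (α [ k ]∙ X)
  kpref : ∀ {α k X X' θ} → Fwd X θ X' → key θ ≢ k →
          Fwd (α [ k ]∙ X) θ (α [ k ]∙ X')
  sumL  : ∀ {X X' Y θ} → Fwd X θ X' → std Y → Fwd (X ⊕ Y) (+L ◃ θ) (X' ⊕ Y)
  sumR  : ∀ {X Y Y' θ} → Fwd Y θ Y' → std X → Fwd (X ⊕ Y) (+R ◃ θ) (X ⊕ Y')
  parL  : ∀ {X X' Y θ} → Fwd X θ X' → ¬ KeyIn (key θ) Y →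
          Fwd (X ∥ Y) (|L ◃ θ) (X' ∥ Y)
  parR  : ∀ {X Y Y' θ} → Fwd Y θ Y' → ¬ KeyIn (key θ) X →
          Fwd (X ∥ Y) (|R ◃ θ) (X ∥ Y')
  sync  : ∀ {X X' Y Y' v₁ v₂ k} (l : Vis) →
          Fwd X (lab v₁ (vis l) k) X' → Fwd Y (lab v₂ (vis (bar l)) k) Y' →
          Fwd (X ∥ Y) (syn [] (lab v₁ (vis l) k) (lab v₂ (vis (bar l)) k)) (X' ∥ Y')
  nu    : ∀ {a X X' θ} → Fwd X θ X' → ℓ θ ≢ vis (nm a) → ℓ θ ≢ vis (co a) →
          Fwd (ν a X) θ (ν a X')

-- Backward transitions: the mirror images of the forward rules (each rule
-- with every transition reversed and the same side conditions), i.e.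
-- exactly the converse relation.
Bwd : Proc → Θ → Proc → Set
Bwd X' θ X = Fwd X θ X'

data Comb : Proc → Θ → Proc → Set where
  fw : ∀ {X θ Y} → Fwd X θ Y → Comb X θ Y
  bw : ∀ {X θ Y} → Bwd X θ Y → Comb X θ Y

-- Paths (processes identified up to α-equivalence: a path may also
-- replace a process by an α-equivalent one)

data Step (X Y : Proc) : Set where
  trans : ∀ {θ} → Comb X θ Y → Step X Y
  alpha : X ≈α Y → Step X Y

data Path : Proc → Proc → Set where
  []  : ∀ {X} → Path X X
  _∷_ : ∀ {X Y Z} → Step X Y → Path Y Z → Path X Z

Reachable : Proc → Set
Reachable X = Σ Proc λ S → std S × Path S X

data Dir : Set where
  L R : Dir

flip : Dir → Dir
flip L = R
flip R = L

|[_] : Dir → Sym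
|[ L ] = |L
|[ R ] = |R

+[_] : Dir → Sym
+[ L ] = +L
+[ R ] = +R

comp : Dir → Θ → Θ → Θ
comp L θL θR = θL
comp R θL θR = θR

infix 4 _⋈_
data _⋈_ : Θ → Θ → Set where
  A¹  : ∀ {α k θ} → lab [] α k ⋈ θ
  A²  : ∀ {α k θ} → θ ⋈ lab [] α k
  P¹  : ∀ {θ₁ θ₂} (D : Dir) → θ₁ ⋈ θ₂ → |[ D ] ◃ θ₁ ⋈ |[ D ] ◃ θ₂
  P²  : ∀ {θ₁ θ₂} (D : Dir) → |[ D ] ◃ θ₁ ⋈ |[ flip D ] ◃ θ₂
  C¹  : ∀ {θ₁ θ₂} (D : Dir) → θ₁ ⋈ θ₂ → +[ D ] ◃ θ₁ ⋈ +[ D ] ◃ θ₂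
  C²  : ∀ {θ₁ θ₂} (D : Dir) → +[ D ] ◃ θ₁ ⋈ +[ flip D ] ◃ θ₂
  S¹  : ∀ {θ θL θR} (D : Dir) → θ ⋈ comp D θL θR → |[ D ] ◃ θ ⋈ syn [] θL θR
  S²  : ∀ {θ θL θR} (D : Dir) → comp D θL θR ⋈ θ → syn [] θL θR ⋈ |[ D ] ◃ θ
  S³  : ∀ {θ₁ θ₂ θ₁' θ₂'} → θ₁ ⋈ θ₁' → θ₂ ⋈ θ₂' → syn [] θ₁ θ₂ ⋈ syn [] θ₁' θ₂'

-- (i) Forgetting labels, keys and restrictions leaves a shape of a process
-- that neither transitions nor α-conversion change, so connected transitions
-- start from processes of the same shape; two forward transitions from
-- processes of the same shape have connected labels, by induction on the two
-- derivations. The only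
-- delicate rule is S³: the two sides of a synchronisation are connected
-- independently and then run side by side, which requires the paths on the
-- two sides to use distinct fresh keys; hence paths carry a key discipline.
module Submission where

open import Defs
open import Level using (0ℓ)
open import Data.Product using (Σ; _×_; _,_)
open import Data.List using ([]; _∷_)
open import Data.Sum using (inj₁; inj₂; [_,_])
open import Data.Nat using (suc; _+_; _<_; s≤s)
open import Data.Nat.Properties using (<⇒≢; m≤m+n; m≤n+m; n<1+n; m<n⇒m<1+n)
open import Data.Empty using (⊥-elim)
open import Relation.Nullary using (¬_)
open import Relation.Unary using (Pred; _∈_; _⊆_; _∪_; _⊥_; ｛_｝; U)
open import Relation.Binary.PropositionalEquality
  using (_≡_; _≢_; refl; sym; cong; cong₂; subst)
  renaming (trans to ≡-trans)

private
  variable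
    X X' Y Y' Z A B : Proc
    θ θ₁ θ₂ : Θ
    P Q : Pred Key 0ℓ

data Shape : Set where
  stop     : Shape
  prefix   : Shape → Shape
  choice   : Shape → Shape → Shape
  parallel : Shape → Shape → Shape

shape : Proc → Shape
shape 𝟎 = stop
shape (α ∙ X) = prefix (shape X)
shape (α [ k ]∙ X) = prefix (shape X)
shape (X ⊕ Y) = choice (shape X) (shape Y)
shape (X ∥ Y) = parallel (shape X) (shape Y)
shape (ν a X) = shape X

prefix-injective : ∀ {s t} → prefix s ≡ prefix t → s ≡ t
prefix-injective refl = refl

choice-injectiveˡ : ∀ {s s' t t'} → choice s t ≡ choice s' t' → s ≡ s'
choice-injectiveˡ refl = refl

choice-injectiveʳ : ∀ {s s' t t'} → choice s t ≡ choice s' t' → t ≡ t'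
choice-injectiveʳ refl = refl

parallel-injectiveˡ : ∀ {s s' t t'} → parallel s t ≡ parallel s' t' → s ≡ s'
parallel-injectiveˡ refl = refl

parallel-injectiveʳ : ∀ {s s' t t'} → parallel s t ≡ parallel s' t' → t ≡ t'
parallel-injectiveʳ refl = refl

shape-swapP : ∀ a b X → shape (swapP a b X) ≡ shape X
shape-swapP a b 𝟎 = refl
shape-swapP a b (α ∙ X) = cong prefix (shape-swapP a b X)
shape-swapP a b (α [ k ]∙ X) = cong prefix (shape-swapP a b X)
shape-swapP a b (X ⊕ Y) = cong₂ choice (shape-swapP a b X) (shape-swapP a b Y)
shape-swapP a b (X ∥ Y) = cong₂ parallel (shape-swapP a b X) (shape-swapP a b Y)
shape-swapP a b (ν c X) = shape-swapP a b X

shape-≈α : X ≈α Y → shape X ≡ shape Y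
shape-≈α nil = refl
shape-≈α (pre e) = cong prefix (shape-≈α e)
shape-≈α (kpre e) = cong prefix (shape-≈α e)
shape-≈α (sum e f) = cong₂ choice (shape-≈α e) (shape-≈α f)
shape-≈α (par e f) = cong₂ parallel (shape-≈α e) (shape-≈α f)
shape-≈α (res e) = shape-≈α e
shape-≈α (res≠ {a} {b} {Y = Y} _ _ e) = ≡-trans (shape-≈α e) (shape-swapP a b Y)

shape-Fwd : Fwd X θ Y → shape X ≡ shape Y
shape-Fwd (pref _) = refl
shape-Fwd (kpref t _) = cong prefix (shape-Fwd t)
shape-Fwd (sumL t _) = cong₂ choice (shape-Fwd t) refl
shape-Fwd (sumR t _) = cong₂ choice refl (shape-Fwd t)
shape-Fwd (parL t _) = cong₂ parallel (shape-Fwd t) refl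
shape-Fwd (parR t _) = cong₂ parallel refl (shape-Fwd t)
shape-Fwd (sync l t u) = cong₂ parallel (shape-Fwd t) (shape-Fwd u)
shape-Fwd (nu t _ _) = shape-Fwd t

shape-Path : Path X Y → shape X ≡ shape Y
shape-Path [] = refl
shape-Path (trans (fw t) ∷ p) = ≡-trans (shape-Fwd t) (shape-Path p)
shape-Path (trans (bw t) ∷ p) = ≡-trans (sym (shape-Fwd t)) (shape-Path p)
shape-Path (alpha e ∷ p) = ≡-trans (shape-≈α e) (shape-Path p)

⋈-of-same-shape : Fwd A θ₁ X → Fwd B θ₂ Y → shape A ≡ shape B → θ₁ ⋈ θ₂
⋈-of-same-shape (pref _) _ _ = A¹
⋈-of-same-shape _ (pref _) _ = A²
⋈-of-same-shape (nu t _ _) u e = ⋈-of-same-shape t u e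
⋈-of-same-shape t (nu u _ _) e = ⋈-of-same-shape t u e
⋈-of-same-shape (kpref t _) (kpref u _) e = ⋈-of-same-shape t u (prefix-injective e)
⋈-of-same-shape (sumL t _) (sumL u _) e = C¹ L (⋈-of-same-shape t u (choice-injectiveˡ e))
⋈-of-same-shape (sumR t _) (sumR u _) e = C¹ R (⋈-of-same-shape t u (choice-injectiveʳ e))
⋈-of-same-shape (sumL _ _) (sumR _ _) _ = C² L
⋈-of-same-shape (sumR _ _) (sumL _ _) _ = C² R
⋈-of-same-shape (parL t _) (parL u _) e = P¹ L (⋈-of-same-shape t u (parallel-injectiveˡ e))
⋈-of-same-shape (parR t _) (parR u _) e = P¹ R (⋈-of-same-shape t u (parallel-injectiveʳ e))
⋈-of-same-shape (parL _ _) (parR _ _) _ = P² L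
⋈-of-same-shape (parR _ _) (parL _ _) _ = P² R
⋈-of-same-shape (parL t _) (sync _ u _) e = S¹ L (⋈-of-same-shape t u (parallel-injectiveˡ e))
⋈-of-same-shape (parR t _) (sync _ _ u) e = S¹ R (⋈-of-same-shape t u (parallel-injectiveʳ e))
⋈-of-same-shape (sync _ t _) (parL u _) e = S² L (⋈-of-same-shape t u (parallel-injectiveˡ e))
⋈-of-same-shape (sync _ _ t) (parR u _) e = S² R (⋈-of-same-shape t u (parallel-injectiveʳ e))
⋈-of-same-shape (sync _ t₁ t₂) (sync _ u₁ u₂) e =
  S³ (⋈-of-same-shape t₁ u₁ (parallel-injectiveˡ e)) (⋈-of-same-shape t₂ u₂ (parallel-injectiveʳ e))
⋈-of-same-shape (kpref _ _) (sumL _ _) ()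
⋈-of-same-shape (kpref _ _) (sumR _ _) ()
⋈-of-same-shape (kpref _ _) (parL _ _) ()
⋈-of-same-shape (kpref _ _) (parR _ _) ()
⋈-of-same-shape (kpref _ _) (sync _ _ _) ()
⋈-of-same-shape (sumL _ _) (kpref _ _) ()
⋈-of-same-shape (sumR _ _) (kpref _ _) ()
⋈-of-same-shape (parL _ _) (kpref _ _) ()
⋈-of-same-shape (parR _ _) (kpref _ _) ()
⋈-of-same-shape (sync _ _ _) (kpref _ _) ()
⋈-of-same-shape (sumL _ _) (parL _ _) ()
⋈-of-same-shape (sumL _ _) (parR _ _) ()
⋈-of-same-shape (sumL _ _) (sync _ _ _) ()
⋈-of-same-shape (sumR _ _) (parL _ _) ()
⋈-of-same-shape (sumR _ _) (parR _ _) ()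
⋈-of-same-shape (sumR _ _) (sync _ _ _) ()
⋈-of-same-shape (parL _ _) (sumL _ _) ()
⋈-of-same-shape (parR _ _) (sumL _ _) ()
⋈-of-same-shape (sync _ _ _) (sumL _ _) ()
⋈-of-same-shape (parL _ _) (sumR _ _) ()
⋈-of-same-shape (parR _ _) (sumR _ _) ()
⋈-of-same-shape (sync _ _ _) (sumR _ _) ()

forward-of-Comb : Comb X θ Y → Σ Proc λ A → Σ Proc λ B → Fwd A θ B × shape A ≡ shape X
forward-of-Comb (fw {X} {θ} {Y} t) = X , Y , t , refl
forward-of-Comb (bw {X} {θ} {Y} t) = Y , X , t , shape-Fwd t

⋈-of-connected : Comb X θ₁ X' → Comb Y θ₂ Y' → Path X Y → θ₁ ⋈ θ₂
⋈-of-connected c₁ c₂ p with forward-of-Comb c₁ | forward-of-Comb c₂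
... | _ , _ , t₁ , e₁ | _ , _ , t₂ , e₂ =
  ⋈-of-same-shape t₁ t₂ (≡-trans e₁ (≡-trans (shape-Path p) (sym e₂)))

keys : Proc → Pred Key 0ℓ
keys X k = KeyIn k X

std⇒keys⊆ : std X → keys X ⊆ P
std⇒keys⊆ s {k} k∈X = ⊥-elim (s k k∈X)

std-𝟎 : std 𝟎
std-𝟎 k ()

std-∙ : ∀ {α} → std X → std (α ∙ X)
std-∙ s k (pre k∈X) = s k k∈X

keys-[]∙⊆ : ∀ {α m} → m ∈ P → std X → keys (α [ m ]∙ X) ⊆ P
keys-[]∙⊆ m∈P s here = m∈P
keys-[]∙⊆ m∈P s (kpre k∈X) = ⊥-elim (s _ k∈X)

key-◃ : ∀ s θ → key (s ◃ θ) ≡ key θ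
key-◃ s (lab v α k) = refl
key-◃ s (syn v θL θR) = refl

data Ctx : Set where
  □∥_ _∥□ □⊕_ _⊕□ : Proc → Ctx

plug : Ctx → Proc → Proc
plug (□∥ Y) X = X ∥ Y
plug (Y ∥□) X = Y ∥ X
plug (□⊕ Y) X = X ⊕ Y
plug (Y ⊕□) X = Y ⊕ X

filler : Ctx → Proc
filler (□∥ Y) = Y
filler (Y ∥□) = Y
filler (□⊕ Y) = Y
filler (Y ⊕□) = Y

tag : Ctx → Sym
tag (□∥ _) = |L
tag (_ ∥□) = |R
tag (□⊕ _) = +L
tag (_ ⊕□) = +R

-- The side condition of the rule lifting a transition with key k into the context.
Admits : Ctx → Pred Key 0ℓ
Admits (□∥ Y) k = ¬ KeyIn k Y
Admits (Y ∥□) k = ¬ KeyIn k Y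
Admits (□⊕ Y) k = std Y
Admits (Y ⊕□) k = std Y

std⇒Admits : ∀ C {k} → std (filler C) → k ∈ Admits C
std⇒Admits (□∥ Y) s = s _
std⇒Admits (Y ∥□) s = s _
std⇒Admits (□⊕ Y) s = s
std⇒Admits (Y ⊕□) s = s

Fwd-plug : ∀ C → Fwd X θ Y → key θ ∈ Admits C → Fwd (plug C X) (tag C ◃ θ) (plug C Y)
Fwd-plug (□∥ _) t a = parL t a
Fwd-plug (_ ∥□) t a = parR t a
Fwd-plug (□⊕ _) t a = sumL t a
Fwd-plug (_ ⊕□) t a = sumR t a

keys-plug : ∀ C → keys (plug C X) ⊆ keys (filler C) ∪ keys X
keys-plug (□∥ _) (parL k∈X) = inj₂ k∈X
keys-plug (□∥ _) (parR k∈Y) = inj₁ k∈Y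
keys-plug (_ ∥□) (parL k∈Y) = inj₁ k∈Y
keys-plug (_ ∥□) (parR k∈X) = inj₂ k∈X
keys-plug (□⊕ _) (sumL k∈X) = inj₂ k∈X
keys-plug (□⊕ _) (sumR k∈Y) = inj₁ k∈Y
keys-plug (_ ⊕□) (sumL k∈Y) = inj₁ k∈Y
keys-plug (_ ⊕□) (sumR k∈X) = inj₂ k∈X

keys-plug⊆ : ∀ C → keys (filler C) ⊆ P → keys X ⊆ P → keys (plug C X) ⊆ P
keys-plug⊆ C F⊆P X⊆P k∈CX = [ F⊆P , X⊆P ] (keys-plug C k∈CX)

std-plug : ∀ C → std (filler C) → std X → std (plug C X)
std-plug C sF sX k k∈CX = [ sF k , sX k ] (keys-plug C k∈CX)

record Realiser (θ : Θ) : Set where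
  constructor realiser
  field
    {source target} : Proc
    source-std : std source
    step : Fwd source θ target

Realiser-plug : ∀ C → std (filler C) → Realiser θ → Realiser (tag C ◃ θ)
Realiser-plug C sF (realiser s t) = realiser (std-plug C sF s) (Fwd-plug C t (std⇒Admits C sF))

Realiser-◃ : ∀ s → Realiser θ → Realiser (s ◃ θ)
Realiser-◃ |L = Realiser-plug (□∥ 𝟎) std-𝟎
Realiser-◃ |R = Realiser-plug (𝟎 ∥□) std-𝟎
Realiser-◃ +L = Realiser-plug (□⊕ 𝟎) std-𝟎
Realiser-◃ +R = Realiser-plug (𝟎 ⊕□) std-𝟎

Realiser-lab : ∀ v α k → Realiser (lab v α k)
Realiser-lab [] α k = realiser (std-∙ std-𝟎) (pref std-𝟎)
Realiser-lab (s ∷ v) α k = Realiser-◃ s (Realiser-lab v α k)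

Realiser-syn : ∀ v v₁ v₂ k l → Realiser (syn v (lab v₁ (vis l) k) (lab v₂ (vis (bar l)) k))
Realiser-syn [] v₁ v₂ k l with Realiser-lab v₁ (vis l) k | Realiser-lab v₂ (vis (bar l)) k
... | realiser s t | realiser s' t' = realiser (std-plug (□∥ _) s' s) (sync l t t')
Realiser-syn (s ∷ v) v₁ v₂ k l = Realiser-◃ s (Realiser-syn v v₁ v₂ k l)

realiser-of-WF : WF θ → Realiser θ
realiser-of-WF (wf-lab {v} {α} {k}) = Realiser-lab v α k
realiser-of-WF (wf-syn {v} {v₁} {v₂} {k} l) = Realiser-syn v v₁ v₂ k l

WF-◃ : ∀ s θ → WF (s ◃ θ) → WF θ
WF-◃ s (lab v α k) _ = wf-lab
WF-◃ s (syn v _ _) (wf-syn l) = wf-syn l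

infixr 5 _∷⟨_⟩_ _++_

data KeyedPath (P : Pred Key 0ℓ) : Proc → Proc → Set where
  []     : KeyedPath P X X
  _∷⟨_⟩_ : Comb X θ Y → key θ ∈ P → KeyedPath P Y Z → KeyedPath P X Z

forget : KeyedPath P X Y → Path X Y
forget [] = []
forget (c ∷⟨ _ ⟩ p) = trans c ∷ forget p

_++_ : KeyedPath P X Y → KeyedPath P Y Z → KeyedPath P X Z
[] ++ q = q
(c ∷⟨ k∈P ⟩ p) ++ q = c ∷⟨ k∈P ⟩ (p ++ q)

weaken : P ⊆ Q → KeyedPath P X Y → KeyedPath Q X Y
weaken P⊆Q [] = []
weaken P⊆Q (c ∷⟨ k∈P ⟩ p) = c ∷⟨ P⊆Q k∈P ⟩ weaken P⊆Q p

KeyedPath-plug : ∀ C → P ⊆ Admits C → KeyedPath P X Y → KeyedPath P (plug C X) (plug C Y)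
KeyedPath-plug C P⊆C [] = []
KeyedPath-plug {P = P} C P⊆C (_∷⟨_⟩_ {θ = θ} c k∈P p) =
  plug-Comb c ∷⟨ subst (_∈ P) (sym (key-◃ (tag C) θ)) k∈P ⟩ KeyedPath-plug C P⊆C p
  where
  plug-Comb : Comb X θ Y → Comb (plug C X) (tag C ◃ θ) (plug C Y)
  plug-Comb (fw t) = fw (Fwd-plug C t (P⊆C k∈P))
  plug-Comb (bw t) = bw (Fwd-plug C t (P⊆C k∈P))

record Connected (P : Pred Key 0ℓ) (X₁ X₂ : Proc) : Set where
  constructor connected
  field
    {origin} : Proc
    origin-std : std origin
    reach : KeyedPath P origin X₁
    path : KeyedPath P X₁ X₂
    keys₁ : keys X₁ ⊆ P
    keys₂ : keys X₂ ⊆ P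

Connected-refl : std X → Connected P X X
Connected-refl {P = P} s = connected s [] [] (std⇒keys⊆ {P = P} s) (std⇒keys⊆ {P = P} s)

Connected-weaken : P ⊆ Q → Connected P X Y → Connected Q X Y
Connected-weaken P⊆Q (connected s r p k₁ k₂) =
  connected s (weaken P⊆Q r) (weaken P⊆Q p) (λ k∈X → P⊆Q (k₁ k∈X)) (λ k∈Y → P⊆Q (k₂ k∈Y))

Connected-plug : ∀ C → std (filler C) → Connected P X Y → Connected P (plug C X) (plug C Y)
Connected-plug {P = P} C sF (connected s r p k₁ k₂) =
  connected (std-plug C sF s)
            (KeyedPath-plug C admits r) (KeyedPath-plug C admits p)
            (keys-plug⊆ C (std⇒keys⊆ {P = P} sF) k₁) (keys-plug⊆ C (std⇒keys⊆ {P = P} sF) k₂)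
  where
  admits : P ⊆ Admits C
  admits _ = std⇒Admits C sF

-- Each side moves while the other one, whose keys lie in the disjoint set,
-- stays put; this is why both sides need a key discipline.
Connected-∥ : P ⊥ Q → Connected P X X' → Connected Q Y Y' → Connected (P ∪ Q) (X ∥ Y) (X' ∥ Y')
Connected-∥ {P = P} {Q = Q} {X = X} {X' = X'} {Y = Y} {Y' = Y'} P⊥Q
    (connected {S} sS rX pX kX kX') (connected {T} sT rY pY kY kY') =
  connected (std-plug (□∥ T) sT sS)
    (weaken into-left (KeyedPath-plug (□∥ T) (λ _ → std⇒Admits (□∥ T) sT) rX)
      ++ weaken into-right (KeyedPath-plug (X ∥□) (avoidsʳ kX) rY))
    (weaken into-left (KeyedPath-plug (□∥ Y) (avoidsˡ kY) pX)
      ++ weaken into-right (KeyedPath-plug (X' ∥□) (avoidsʳ kX') pY))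
    (keys-plug⊆ {P = P ∪ Q} (□∥ Y) (λ k∈Y → inj₂ (kY k∈Y)) (λ k∈X → inj₁ (kX k∈X)))
    (keys-plug⊆ {P = P ∪ Q} (□∥ Y') (λ k∈Y → inj₂ (kY' k∈Y)) (λ k∈X → inj₁ (kX' k∈X)))
  where
  into-left : P ⊆ P ∪ Q
  into-left = inj₁
  into-right : Q ⊆ P ∪ Q
  into-right = inj₂
  avoidsˡ : ∀ {W} → keys W ⊆ Q → P ⊆ λ k → ¬ KeyIn k W
  avoidsˡ W⊆Q {k} k∈P k∈W = P⊥Q {k} (k∈P , W⊆Q k∈W)
  avoidsʳ : ∀ {W} → keys W ⊆ P → Q ⊆ λ k → ¬ KeyIn k W
  avoidsʳ W⊆P {k} k∈Q k∈W = P⊥Q {k} (W⊆P k∈W , k∈Q)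

Connected-pref : ∀ {α m S} → m ∈ P → std S → Connected P (α ∙ S) (α [ m ]∙ S)
Connected-pref {P = P} m∈P s =
  connected (std-∙ s) [] (fw (pref s) ∷⟨ m∈P ⟩ []) (std⇒keys⊆ {P = P} (std-∙ s)) (keys-[]∙⊆ m∈P s)

Connected-unpref : ∀ {α m S} → m ∈ P → std S → Connected P (α [ m ]∙ S) (α ∙ S)
Connected-unpref {P = P} m∈P s =
  connected (std-∙ s) (fw (pref s) ∷⟨ m∈P ⟩ []) (bw (pref s) ∷⟨ m∈P ⟩ [])
    (keys-[]∙⊆ m∈P s) (std⇒keys⊆ {P = P} (std-∙ s))

record Realisation (P : Pred Key 0ℓ) (θ₁ θ₂ : Θ) : Set where
  constructor realisation
  field
    {X₁ X₁' X₂ X₂'} : Proc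
    step₁ : Fwd X₁ θ₁ X₁'
    step₂ : Fwd X₂ θ₂ X₂'
    linked : Connected P X₁ X₂

Realisation-plug : ∀ C → std (filler C) → Realisation P θ₁ θ₂ →
                   Realisation P (tag C ◃ θ₁) (tag C ◃ θ₂)
Realisation-plug C sF (realisation t₁ t₂ c) =
  realisation (Fwd-plug C t₁ (std⇒Admits C sF)) (Fwd-plug C t₂ (std⇒Admits C sF))
              (Connected-plug C sF c)

Realisation-◃ : ∀ s → Realisation P θ₁ θ₂ → Realisation P (s ◃ θ₁) (s ◃ θ₂)
Realisation-◃ |L = Realisation-plug (□∥ 𝟎) std-𝟎
Realisation-◃ |R = Realisation-plug (𝟎 ∥□) std-𝟎
Realisation-◃ +L = Realisation-plug (□⊕ 𝟎) std-𝟎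
Realisation-◃ +R = Realisation-plug (𝟎 ⊕□) std-𝟎

Realisation-A¹ : ∀ {α k m} → m ∈ P → key θ ≢ m → Realiser θ → Realisation P (lab [] α k) θ
Realisation-A¹ m∈P θ≢m (realiser s t) = realisation (pref s) (kpref t θ≢m) (Connected-pref m∈P s)

Realisation-A² : ∀ {α k m} → m ∈ P → key θ ≢ m → Realiser θ → Realisation P θ (lab [] α k)
Realisation-A² m∈P θ≢m (realiser s t) = realisation (kpref t θ≢m) (pref s) (Connected-unpref m∈P s)

Realisation-P² : ∀ D → Realiser θ₁ → Realiser θ₂ → Realisation P (|[ D ] ◃ θ₁) (|[ flip D ] ◃ θ₂)
Realisation-P² L (realiser s t) (realiser s' t') =
  realisation (parL t (s' _)) (parR t' (s _)) (Connected-refl (std-plug (□∥ _) s' s))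
Realisation-P² R (realiser s t) (realiser s' t') =
  realisation (parR t (s' _)) (parL t' (s _)) (Connected-refl (std-plug (_ ∥□) s' s))

Realisation-C² : ∀ D → Realiser θ₁ → Realiser θ₂ → Realisation P (+[ D ] ◃ θ₁) (+[ flip D ] ◃ θ₂)
Realisation-C² L (realiser s t) (realiser s' t') =
  realisation (sumL t s') (sumR t' s) (Connected-refl (std-plug (□⊕ _) s' s))
Realisation-C² R (realiser s t) (realiser s' t') =
  realisation (sumR t s') (sumL t' s) (Connected-refl (std-plug (_ ⊕□) s' s))

data IsLab : Θ → Set where
  is-lab : ∀ {v α k} → IsLab (lab v α k)

IsLab-◃ : ∀ s θ → IsLab (s ◃ θ) → IsLab θ
IsLab-◃ s (lab v α k) _ = is-lab

Realiser-IsLab : IsLab θ → Realiser θ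
Realiser-IsLab (is-lab {v} {α} {k}) = Realiser-lab v α k

key-◃≢ : ∀ {m} s θ → key (s ◃ θ) ≢ m → key θ ≢ m
key-◃≢ s θ = subst (_≢ _) (key-◃ s θ)

-- Between plain labels only the rules A, P and C apply, and the single key m
-- is the only one ever introduced.
realise-labels : ∀ m → IsLab θ₁ → IsLab θ₂ → key θ₁ ≢ m → key θ₂ ≢ m →
                 θ₁ ⋈ θ₂ → Realisation ｛ m ｝ θ₁ θ₂
realise-labels m _ i₂ _ θ₂≢m A¹ = Realisation-A¹ refl θ₂≢m (Realiser-IsLab i₂)
realise-labels m i₁ _ θ₁≢m _ A² = Realisation-A² refl θ₁≢m (Realiser-IsLab i₁)
realise-labels m i₁ i₂ θ₁≢m θ₂≢m (P¹ {θ₁} {θ₂} D p) =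
  Realisation-◃ |[ D ] (realise-labels m (IsLab-◃ _ θ₁ i₁) (IsLab-◃ _ θ₂ i₂)
                          (key-◃≢ |[ D ] θ₁ θ₁≢m) (key-◃≢ |[ D ] θ₂ θ₂≢m) p)
realise-labels m i₁ i₂ θ₁≢m θ₂≢m (C¹ {θ₁} {θ₂} D p) =
  Realisation-◃ +[ D ] (realise-labels m (IsLab-◃ _ θ₁ i₁) (IsLab-◃ _ θ₂ i₂)
                          (key-◃≢ +[ D ] θ₁ θ₁≢m) (key-◃≢ +[ D ] θ₂ θ₂≢m) p)
realise-labels m i₁ i₂ _ _ (P² {θ₁} {θ₂} D) =
  Realisation-P² D (Realiser-IsLab (IsLab-◃ |[ D ] θ₁ i₁)) (Realiser-IsLab (IsLab-◃ |[ flip D ] θ₂ i₂))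
realise-labels m i₁ i₂ _ _ (C² {θ₁} {θ₂} D) =
  Realisation-C² D (Realiser-IsLab (IsLab-◃ +[ D ] θ₁ i₁)) (Realiser-IsLab (IsLab-◃ +[ flip D ] θ₂ i₂))
realise-labels m i₁ () _ _ (S¹ D p)
realise-labels m () i₂ _ _ (S² D p)
realise-labels m () i₂ _ _ (S³ p q)

WF-comp : ∀ {v₁ v₂ k l} D → WF (comp D (lab v₁ (vis l) k) (lab v₂ (vis (bar l)) k))
WF-comp L = wf-lab
WF-comp R = wf-lab

Realisation-S¹ : ∀ {v₁ v₂ k} D l →
  Realisation P θ (comp D (lab v₁ (vis l) k) (lab v₂ (vis (bar l)) k)) →
  Realisation P (|[ D ] ◃ θ) (syn [] (lab v₁ (vis l) k) (lab v₂ (vis (bar l)) k))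
Realisation-S¹ {v₂ = v₂} {k} L l (realisation t₁ t₂ c) with Realiser-lab v₂ (vis (bar l)) k
... | realiser sY tY = realisation (parL t₁ (sY _)) (sync l t₂ tY) (Connected-plug (□∥ _) sY c)
Realisation-S¹ {v₁ = v₁} {k = k} R l (realisation t₁ t₂ c) with Realiser-lab v₁ (vis l) k
... | realiser sY tY = realisation (parR t₁ (sY _)) (sync l tY t₂) (Connected-plug (_ ∥□) sY c)

Realisation-S² : ∀ {v₁ v₂ k} D l →
  Realisation P (comp D (lab v₁ (vis l) k) (lab v₂ (vis (bar l)) k)) θ →
  Realisation P (syn [] (lab v₁ (vis l) k) (lab v₂ (vis (bar l)) k)) (|[ D ] ◃ θ)
Realisation-S² {v₂ = v₂} {k} L l (realisation t₁ t₂ c) with Realiser-lab v₂ (vis (bar l)) k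
... | realiser sY tY = realisation (sync l t₁ tY) (parL t₂ (sY _)) (Connected-plug (□∥ _) sY c)
Realisation-S² {v₁ = v₁} {k = k} R l (realisation t₁ t₂ c) with Realiser-lab v₁ (vis l) k
... | realiser sY tY = realisation (sync l tY t₁) (parR t₂ (sY _)) (Connected-plug (_ ∥□) sY c)

Realisation-S³ : ∀ {v₁ v₂ v₁' v₂' k k' m m'} l l' → m ≢ m' →
  Realisation ｛ m ｝ (lab v₁ (vis l) k) (lab v₁' (vis l') k') →
  Realisation ｛ m' ｝ (lab v₂ (vis (bar l)) k) (lab v₂' (vis (bar l')) k') →
  Realisation U (syn [] (lab v₁ (vis l) k) (lab v₂ (vis (bar l)) k))
                (syn [] (lab v₁' (vis l') k') (lab v₂' (vis (bar l')) k'))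
Realisation-S³ {m = m} {m'} l l' m≢m' (realisation t₁ t₂ c) (realisation u₁ u₂ d) =
  realisation (sync l t₁ u₁) (sync l' t₂ u₂) (Connected-weaken _ (Connected-∥ disjoint c d))
  where
  disjoint : ｛ m ｝ ⊥ ｛ m' ｝
  disjoint (refl , refl) = m≢m' refl

realise : WF θ₁ → WF θ₂ → θ₁ ⋈ θ₂ → Realisation U θ₁ θ₂
realise _ w₂ (A¹ {θ = θ}) = Realisation-A¹ _ (<⇒≢ (n<1+n (key θ))) (realiser-of-WF w₂)
realise w₁ _ (A² {θ = θ}) = Realisation-A² _ (<⇒≢ (n<1+n (key θ))) (realiser-of-WF w₁)
realise w₁ w₂ (P¹ {θ₁} {θ₂} D p) = Realisation-◃ |[ D ] (realise (WF-◃ _ θ₁ w₁) (WF-◃ _ θ₂ w₂) p)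
realise w₁ w₂ (C¹ {θ₁} {θ₂} D p) = Realisation-◃ +[ D ] (realise (WF-◃ _ θ₁ w₁) (WF-◃ _ θ₂ w₂) p)
realise w₁ w₂ (P² {θ₁} {θ₂} D) =
  Realisation-P² D (realiser-of-WF (WF-◃ |[ D ] θ₁ w₁)) (realiser-of-WF (WF-◃ |[ flip D ] θ₂ w₂))
realise w₁ w₂ (C² {θ₁} {θ₂} D) =
  Realisation-C² D (realiser-of-WF (WF-◃ +[ D ] θ₁ w₁)) (realiser-of-WF (WF-◃ +[ flip D ] θ₂ w₂))
realise w₁ (wf-syn l) (S¹ {θ} D p) = Realisation-S¹ D l (realise (WF-◃ |[ D ] θ w₁) (WF-comp D) p)
realise (wf-syn l) w₂ (S² {θ} D p) = Realisation-S² D l (realise (WF-comp D) (WF-◃ |[ D ] θ w₂) p)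
realise (wf-syn {k = k} l) (wf-syn {k = k'} l') (S³ p q) =
  Realisation-S³ l l' (<⇒≢ (n<1+n m))
    (realise-labels m is-lab is-lab (<⇒≢ k<m) (<⇒≢ k'<m) p)
    (realise-labels (suc m) is-lab is-lab (<⇒≢ (m<n⇒m<1+n k<m)) (<⇒≢ (m<n⇒m<1+n k'<m)) q)
  where
  m : Key
  m = suc (k + k')
  k<m : k < m
  k<m = s≤s (m≤m+n k k')
  k'<m : k' < m
  k'<m = s≤s (m≤n+m k' k)

theorem1 :
    ((X₁ X₁' X₂ X₂' : Proc) (θ₁ θ₂ : Θ) →
      Comb X₁ θ₁ X₁' → Comb X₂ θ₂ X₂' →
      Path X₁ X₂ → Reachable X₁ → θ₁ ⋈ θ₂)
    ×
    ((θ₁ θ₂ : Θ) → WF θ₁ → WF θ₂ → θ₁ ⋈ θ₂ →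
      Σ Proc λ X₁ → Σ Proc λ X₁' → Σ Proc λ X₂ → Σ Proc λ X₂' →
        Comb X₁ θ₁ X₁' × Comb X₂ θ₂ X₂' × Reachable X₁ × Path X₁ X₂)
theorem1 = (λ _ _ _ _ _ _ c₁ c₂ p _ → ⋈-of-connected c₁ c₂ p)
         , λ _ _ w₁ w₂ θ₁⋈θ₂ → witnesses (realise w₁ w₂ θ₁⋈θ₂)
  where
  witnesses : Realisation U θ₁ θ₂ →
              Σ Proc λ X₁ → Σ Proc λ X₁' → Σ Proc λ X₂ → Σ Proc λ X₂' →
                Comb X₁ θ₁ X₁' × Comb X₂ θ₂ X₂' × Reachable X₁ × Path X₁ X₂
  witnesses (realisation t₁ t₂ (connected s r p _ _)) =
    _ , _ , _ , _ , fw t₁ , fw t₂ , (_ , s , forget r) , forget p
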